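{- No ultrafilter in NMAX is an L-limit; that is, if $\mathcal F\in\beta N$ is $N$-free and $\mathcal G\,\widetilde{\mid}\,\mathcal F$ for every $N$-free $\mathcal G\in\beta N$, then there is no $\widetilde{\mid}$-chain $\langle\mathcal G_n:n<\omega\rangle$ with $\mathcal G_n\in\overline{L_n}$ for each $n$ such that $\mathcal F$ is a $\widetilde{\mid}$-smallest upper bound of $\{\mathcal G_n:n<\omega\}$.
   Context: $N=\{1,2,\dots\}$, $nN=\{nm:m\in N\}$, $\beta N$ the set of ultrafilters on $N$. $A\uparrow=\{n:\exists a\in A\ a\mid n\}$, $\mathcal U=\{A\subseteq N:A\uparrow=A\}$, $\mathcal F\,\widetilde{\mid}\,\mathcal G\iff\mathcal F\cap\mathcal U\subseteq\mathcal G$; $=_\sim$ is mutual divisibility and smallest upper bounds are taken up to $=_\sim$. An ultrafilter is $N$-free if it contains no $nN$ with $n>1$; NMAX is the $=_\sim$-class of $N$-free ultrafilters $\widetilde{\mid}$-divisible by all $N$-free ultrafilters. For $n\ge 0$, $L_n$ is the set of natural numbers with exactly $n$ prime factors counted with multiplicity, and $\overline{L_n}=\{\mathcal G\in\beta N:L_n\in\mathcal G\}$. A chain $\langle\mathcal G_n:n<\omega\rangle$ means $\mathcal G_n\,\widetilde{\mid}\,\mathcal G_m$ for $n\le m$. -}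

module Defs where

open import Data.Nat using (ℕ; zero; suc; _*_; _≤_; _<_)
open import Data.Nat.Divisibility using (_∣_)
open import Data.Nat.Primality using (Prime)
open import Data.Product using (Σ; ∃; _×_; _,_)
open import Data.Sum using (_⊎_)
open import Data.Empty using (⊥)
open import Relation.Nullary using (¬_)
open import Relation.Binary.PropositionalEquality using (_≡_)

-- Subsets of ℕ as predicates.  The paper's N = {1,2,...} is the
-- subset Pos of ℕ; ultrafilters on N are represented as ultrafilters
-- on ℕ containing Pos (equivalently: ultrafilters on N).
Subset : Set₁
Subset = ℕ → Set

Pos : Subset
Pos n = 1 ≤ n

_⊆_ : Subset → Subset → Set
A ⊆ B = ∀ n → A n → B n

_≐_ : Subset → Subset → Set
A ≐ B = (A ⊆ B) × (B ⊆ A)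

_∩_ : Subset → Subset → Subset
(A ∩ B) n = A n × B n

∁ : Subset → Subset
∁ A n = ¬ A n

∅ : Subset
∅ _ = ⊥

record Ultrafilter : Set₁ where
  field
    _∈F : Subset → Set
    pos∈     : Pos ∈F
    ∅∉       : ¬ (∅ ∈F)
    upward   : ∀ A B → A ∈F → A ⊆ B → B ∈F
    inter    : ∀ A B → A ∈F → B ∈F → (A ∩ B) ∈F
    ultra    : ∀ A → A ∈F ⊎ (∁ A) ∈F
open Ultrafilter public

_ℕ-multiples : ℕ → Subset
(n ℕ-multiples) k = Σ ℕ λ m → Pos m × (k ≡ n * m)

_↑ : Subset → Subset
(A ↑) n = Pos n × Σ ℕ λ a → A a × a ∣ n

InU : Subset → Set
InU A = (A ⊆ Pos) × ((A ↑) ≐ A)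

_~∣_ : Ultrafilter → Ultrafilter → Set₁
F ~∣ G = ∀ A → InU A → (F ∈F) A → (G ∈F) A

NFree : Ultrafilter → Set
NFree F = ∀ n → 1 < n → ¬ ((F ∈F) (n ℕ-multiples))

InNMAX : Ultrafilter → Set₁
InNMAX F = NFree F × (∀ G → NFree G → G ~∣ F)

data HasPrimeFactors : ℕ → ℕ → Set where
  one  : HasPrimeFactors 0 1
  step : ∀ {k m p} → Prime p → HasPrimeFactors k m →
         HasPrimeFactors (suc k) (p * m)

L : ℕ → Subset
L k m = HasPrimeFactors k m

IsChain : (ℕ → Ultrafilter) → Set₁
IsChain G = ∀ n m → n ≤ m → G n ~∣ G m

IsSmallestUB : Ultrafilter → (ℕ → Ultrafilter) → Set₁
IsSmallestUB F G =
  (∀ n → G n ~∣ F) × (∀ H → (∀ n → G n ~∣ H) → F ~∣ H)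

-- Let R m = ∏ {p ^ (p - 1) : p ≤ m prime} and B = {y : y ∤ R y}.  B is upward
-- closed, since the factors of R beyond d are coprime to d.  No p ^ p divides
-- any R m, so x ^ x ∈ B for x ≥ 2; as x ↦ x ^ x maps N-free ultrafilters to
-- N-free ones, B belongs to every ultrafilter in NMAX.  On the other hand,
-- every a ∈ L n whose prime factors all exceed n divides R a, and each G n,
-- lying below an N-free ultrafilter, contains such numbers.  Hence the image
-- of F under x ↦ gcd x (R x) is an upper bound of the G n and so contains B,
-- although gcd x (R x) never lies in B.
module Submission where

open import Defs
open import Algebra.Properties.CommutativeSemigroup using (interchange)
open import Data.Empty using (⊥-elim)
open import Data.List using (List; []; _∷_)
open import Data.List.Relation.Unary.All using (All; _∷_)
open import Data.Nat using (ℕ; zero; suc; pred; _*_; _^_; _≤_; _<_; _<?_; z≤n; s≤s; >-nonZero; nonTrivial⇒n>1)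
open import Data.Nat.Coprimality using (Coprime; coprime-divisor; prime⇒coprime; 1-coprimeTo; sym)
open import Data.Nat.Divisibility
open import Data.Nat.GCD using (gcd; gcd[m,n]∣n; gcd-greatest; gcd[m,n]≢0)
open import Data.Nat.ListAction using (product)
open import Data.Nat.Primality using (Prime; prime?; prime⇒nonTrivial; prime⇒nonZero; ¬prime[1]; euclidsLemma)
open import Data.Nat.Primality.Factorisation using (factorise; PrimeFactorisation)
open import Data.Nat.Properties using (*-comm; *-commutativeSemigroup; *-mono-≤; ^-zeroˡ; m≤m*n; m≤n*m; m^n>0; m^n≢0; n≢0⇒n>0; ≤-total; ≤-trans; ≤-<-trans; <⇒≤pred; m≤n⇒m<n∨m≡n; ≤-refl; n≤1+n; <-irrefl)
open import Data.Product using (∃; _×_; _,_; proj₁)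
open import Data.Sum using (_⊎_; inj₁; inj₂)
open import Relation.Nullary using (¬_; yes; no)
open import Relation.Binary.PropositionalEquality using (_≡_; refl; trans; cong; subst; subst₂)
  renaming (sym to ≡-sym)

image : (f : ℕ → ℕ) → (∀ x → Pos x → Pos (f x)) → Ultrafilter → Ultrafilter
image f f-pos F = record
  { _∈F    = λ A → (F ∈F) (λ x → A (f x))
  ; pos∈   = upward F Pos _ (pos∈ F) f-pos
  ; ∅∉     = ∅∉ F
  ; upward = λ A B A∈ A⊆B → upward F _ _ A∈ (λ x → A⊆B (f x))
  ; inter  = λ A B → inter F _ _
  ; ultra  = λ A → ultra F (λ x → A (f x))
  }

InU-intro : {A : Subset} → A ⊆ Pos → (∀ {a y} → A a → a ∣ y → Pos y → A y) → InU A
InU-intro {A} A⊆Pos closed = A⊆Pos , (A↑⊆A , λ a Aa → A⊆Pos a Aa , a , Aa , ∣-refl)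
  where
  A↑⊆A : (A ↑) ⊆ A
  A↑⊆A y (y>0 , a , Aa , a∣y) = closed Aa a∣y y>0

InU-upward : {A : Subset} → InU A → ∀ {a y} → A a → a ∣ y → Pos y → A y
InU-upward (_ , (A↑⊆A , _)) {a} {y} Aa a∣y y>0 = A↑⊆A y (y>0 , a , Aa , a∣y)

↑-InU : (A : Subset) → InU (A ↑)
↑-InU A = InU-intro (λ _ → proj₁) λ (_ , b , Ab , b∣a) a∣y y>0 → y>0 , b , Ab , ∣-trans b∣a a∣y

∈F-↑ : (F : Ultrafilter) {A : Subset} → (F ∈F) A → (F ∈F) (A ↑)
∈F-↑ F A∈F = upward F _ _ (inter F _ _ A∈F (pos∈ F)) λ x (Ax , x>0) → x>0 , x , Ax , ∣-refl

~∣-↑ : (G F : Ultrafilter) (A : Subset) → G ~∣ F → (G ∈F) A → (F ∈F) (A ↑)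
~∣-↑ G F A G~∣F A∈G = G~∣F (A ↑) (↑-InU A) (∈F-↑ G A∈G)

prime>1 : ∀ {p} → Prime p → 1 < p
prime>1 {p} p-prime = nonTrivial⇒n>1 p {{prime⇒nonTrivial p-prime}}

prime∧coprime⇒∤ : ∀ {p n} → Prime p → Coprime p n → ¬ p ∣ n
prime∧coprime⇒∤ p-prime coprime p∣n = ¬prime[1] (subst Prime (coprime (∣-refl , p∣n)) p-prime)

primeDivisor : ∀ {n} → 1 < n → ∃ λ p → Prime p × p ∣ n
primeDivisor {n} n>1 = go (factors fact) (isFactorisation fact) (factorsPrime fact)
  where
  open PrimeFactorisation
  fact : PrimeFactorisation n
  fact = factorise n {{>-nonZero (≤-trans (s≤s z≤n) n>1)}}
  go : (ps : List ℕ) → n ≡ product ps → All Prime ps → ∃ λ p → Prime p × p ∣ n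
  go []       n≡1 _             = ⊥-elim (<-irrefl refl (subst (1 <_) n≡1 n>1))
  go (p ∷ ps) n≡ (p-prime ∷ _) =
    p , p-prime , divides (product ps) (trans n≡ (*-comm p (product ps)))

prime∣^⇒∣ : ∀ {p y} → Prime p → ∀ k → p ∣ y ^ k → p ∣ y
prime∣^⇒∣ p-prime zero    p∣1 = ⊥-elim (¬prime[1] (subst Prime (∣1⇒≡1 p∣1) p-prime))
prime∣^⇒∣ {y = y} p-prime (suc k) p∣y^sk with euclidsLemma y (y ^ k) p-prime p∣y^sk
... | inj₁ p∣y   = p∣y
... | inj₂ p∣y^k = prime∣^⇒∣ p-prime k p∣y^k

∣⇒multiple : ∀ {n x} → Pos x → n ∣ x → (n ℕ-multiples) x
∣⇒multiple {n} {suc _} _ (divides (suc q) x≡q*n) =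
  suc q , s≤s z≤n , trans x≡q*n (*-comm (suc q) n)

multiple⇒∣ : ∀ {n x} → (n ℕ-multiples) x → n ∣ x
multiple⇒∣ {n} (m , _ , x≡n*m) = divides m (trans x≡n*m (*-comm n m))

hasPrimeFactors⇒pos : ∀ {k a} → HasPrimeFactors k a → Pos a
hasPrimeFactors⇒pos one              = s≤s z≤n
hasPrimeFactors⇒pos (step p-prime h) =
  *-mono-≤ (≤-trans (s≤s z≤n) (prime>1 p-prime)) (hasPrimeFactors⇒pos h)

^-monoʳ-∣ : ∀ j {k l} → k ≤ l → j ^ k ∣ j ^ l
^-monoʳ-∣ j {l = l} z≤n       = 1∣ (j ^ l)
^-monoʳ-∣ j         (s≤s k≤l) = *-monoʳ-∣ j (^-monoʳ-∣ j k≤l)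

^-monoˡ-∣ : ∀ {a b} k → a ∣ b → a ^ k ∣ b ^ k
^-monoˡ-∣ zero    a∣b = ∣-refl
^-monoˡ-∣ (suc k) a∣b = *-pres-∣ a∣b (^-monoˡ-∣ k a∣b)

coprime-* : ∀ {d a b} → Coprime d a → Coprime d b → Coprime d (a * b)
coprime-* coprime-a coprime-b (i∣d , i∣ab) =
  coprime-b (i∣d , coprime-divisor (λ (j∣i , j∣a) → coprime-a (∣-trans j∣i i∣d , j∣a)) i∣ab)

coprime-^ : ∀ {d a} → Coprime d a → ∀ k → Coprime d (a ^ k)
coprime-^ {d} coprime zero    = sym (1-coprimeTo d)
coprime-^     coprime (suc k) = coprime-* coprime (coprime-^ coprime k)

Π : (ℕ → ℕ) → ℕ → ℕ
Π f zero    = 1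
Π f (suc m) = f (suc m) * Π f m

Π-mono-∣ : ∀ f {m n} → m ≤ n → Π f m ∣ Π f n
Π-mono-∣ f {n = zero}  z≤n = ∣-refl
Π-mono-∣ f {n = suc n} m≤sn with m≤n⇒m<n∨m≡n m≤sn
... | inj₂ refl      = ∣-refl
... | inj₁ (s≤s m≤n) = ∣-trans (Π-mono-∣ f m≤n) (n∣m*n (f (suc n)))

Π-pres-∣ : ∀ {f g} → (∀ i → f i ∣ g i) → ∀ m → Π f m ∣ Π g m
Π-pres-∣ f∣g zero    = ∣-refl
Π-pres-∣ f∣g (suc m) = *-pres-∣ (f∣g (suc m)) (Π-pres-∣ f∣g m)

Π-* : ∀ f g m → Π (λ i → f i * g i) m ≡ Π f m * Π g m
Π-* f g zero    = refl
Π-* f g (suc m) = trans (cong (f (suc m) * g (suc m) *_) (Π-* f g m))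
                        (interchange *-commutativeSemigroup (f (suc m)) (g (suc m)) (Π f m) (Π g m))

∣Π : ∀ f {i m} → 1 ≤ i → i ≤ m → f i ∣ Π f m
∣Π f {suc i} _ i≤m = ∣-trans (m∣m*n (Π f i)) (Π-mono-∣ f i≤m)

coprime-Π : ∀ {d} f m → (∀ i → i ≤ m → Coprime d (f i)) → Coprime d (Π f m)
coprime-Π {d} f zero    _        = sym (1-coprimeTo d)
coprime-Π     f (suc m) coprimes =
  coprime-* (coprimes (suc m) ≤-refl)
            (coprime-Π f m λ i i≤m → coprimes i (≤-trans i≤m (n≤1+n m)))

Π-cancel : ∀ {d} f {j m} → (∀ k → j < k → Coprime d (f k)) → j ≤ m → d ∣ Π f m → d ∣ Π f j
Π-cancel f {m = zero}  _        z≤n   d∣Π = d∣Π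
Π-cancel f {m = suc m} coprimes j≤sm d∣Π with m≤n⇒m<n∨m≡n j≤sm
... | inj₂ refl      = d∣Π
... | inj₁ (s≤s j≤m) = Π-cancel f coprimes j≤m (coprime-divisor (coprimes (suc m) (s≤s j≤m)) d∣Π)

primeAbove : ℕ → ℕ → ℕ
primeAbove n j with prime? j | n <? j
... | yes _ | yes _ = j
... | _     | _     = 1

primeAbove-cases : ∀ n j → primeAbove n j ≡ 1 ⊎ (Prime j × n < j × primeAbove n j ≡ j)
primeAbove-cases n j with prime? j | n <? j
... | yes j-prime | yes n<j = inj₂ (j-prime , n<j , refl)
... | yes _       | no _    = inj₁ refl
... | no _        | _       = inj₁ refl

primeAbove-≡ : ∀ {n j} → Prime j → n < j → primeAbove n j ≡ j
primeAbove-≡ {n} {j} j-prime n<j with prime? j | n <? j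
... | yes _     | yes _  = refl
... | yes _     | no n≮j = ⊥-elim (n≮j n<j)
... | no ¬prime | _      = ⊥-elim (¬prime j-prime)

coprime-primeAbove : ∀ {d} n j → (Prime j → Coprime d j) → Coprime d (primeAbove n j)
coprime-primeAbove {d} n j coprime with primeAbove-cases n j
... | inj₁ ≡1                  = subst (Coprime d) (≡-sym ≡1) (sym (1-coprimeTo d))
... | inj₂ (j-prime , _ , ≡j) = subst (Coprime d) (≡-sym ≡j) (coprime j-prime)

R-factor : ℕ → ℕ
R-factor j = primeAbove 0 j ^ pred j

R : ℕ → ℕ
R = Π R-factor

coprime-R-factor : ∀ {d} j → (Prime j → Coprime d j) → Coprime d (R-factor j)
coprime-R-factor j coprime = coprime-^ (coprime-primeAbove 0 j coprime) (pred j)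

∣R⇒∣R-self : ∀ {d} m → 1 ≤ d → d ∣ R m → d ∣ R d
∣R⇒∣R-self {d} m d≥1 d∣Rm with ≤-total m d
... | inj₁ m≤d = ∣-trans d∣Rm (Π-mono-∣ R-factor m≤d)
... | inj₂ d≤m = Π-cancel R-factor coprime d≤m d∣Rm
  where
  coprime : ∀ k → d < k → Coprime d (R-factor k)
  coprime k d<k = coprime-R-factor k λ k-prime → sym (prime⇒coprime k-prime {{>-nonZero d≥1}} d<k)

p^p∤R[p] : ∀ {p} → Prime p → ¬ p ^ p ∣ R p
p^p∤R[p] {suc p} p-prime p^p∣R = prime∧coprime⇒∤ p-prime R[p-1]-coprime p∣R[p-1]
  where
  R[p-1]-coprime : Coprime (suc p) (R p)
  R[p-1]-coprime = coprime-Π R-factor p λ k k≤p →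
    coprime-R-factor k λ k-prime → prime⇒coprime p-prime {{prime⇒nonZero k-prime}} (s≤s k≤p)
  p∣R[p-1] : suc p ∣ R p
  p∣R[p-1] = *-cancelˡ-∣ (suc p ^ p) {{m^n≢0 (suc p) p}}
    (subst₂ _∣_ (*-comm (suc p) (suc p ^ p))
                (cong (λ q → q ^ p * R p) (primeAbove-≡ p-prime (s≤s z≤n))) p^p∣R)

p^p∤R : ∀ {p} m → Prime p → ¬ p ^ p ∣ R m
p^p∤R {p} m p-prime p^p∣Rm with ≤-total m p
... | inj₁ m≤p = p^p∤R[p] p-prime (∣-trans p^p∣Rm (Π-mono-∣ R-factor m≤p))
... | inj₂ p≤m = p^p∤R[p] p-prime (Π-cancel R-factor coprime p≤m p^p∣Rm)
  where
  coprime : ∀ k → p < k → Coprime (p ^ p) (R-factor k)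
  coprime k p<k = sym (coprime-^ (sym (coprime-R-factor k λ k-prime →
    sym (prime⇒coprime k-prime {{prime⇒nonZero p-prime}} p<k))) p)

PrimeFactorsAbove : ℕ → Subset
PrimeFactorsAbove n a = ∀ p → Prime p → p ∣ a → n < p

PrimeFactorsAbove-∣ : ∀ {n a b} → a ∣ b → PrimeFactorsAbove n b → PrimeFactorsAbove n a
PrimeFactorsAbove-∣ a∣b above p p-prime p∣a = above p p-prime (∣-trans p∣a a∣b)

∣Π-primeAbove^ : ∀ {n k a} → HasPrimeFactors k a → PrimeFactorsAbove n a →
                 a ∣ Π (λ j → primeAbove n j ^ k) a
∣Π-primeAbove^ one _ = 1∣ _
∣Π-primeAbove^ {n} (step {k} {m} {q} q-prime m-factors) above =
  ∣-trans (*-pres-∣ q∣ m∣)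
          (∣-reflexive (≡-sym (Π-* (primeAbove n) (λ j → primeAbove n j ^ k) (q * m))))
  where
  instance
    q≢0 = prime⇒nonZero q-prime
    m≢0 = >-nonZero (hasPrimeFactors⇒pos m-factors)
  q∣ : q ∣ Π (primeAbove n) (q * m)
  q∣ = subst (_∣ Π (primeAbove n) (q * m)) (primeAbove-≡ q-prime (above q q-prime (m∣m*n m)))
             (∣Π (primeAbove n) (≤-trans (s≤s z≤n) (prime>1 q-prime)) (m≤m*n q m))
  m∣ : m ∣ Π (λ j → primeAbove n j ^ k) (q * m)
  m∣ = ∣-trans (∣Π-primeAbove^ m-factors (PrimeFactorsAbove-∣ (n∣m*n q) above))
               (Π-mono-∣ _ (m≤n*m m q))

primeAbove^∣R-factor : ∀ n j → primeAbove n j ^ n ∣ R-factor j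
primeAbove^∣R-factor n j with primeAbove-cases n j
... | inj₁ ≡1 = subst (_∣ R-factor j) (≡-sym (trans (cong (_^ n) ≡1) (^-zeroˡ n))) (1∣ R-factor j)
... | inj₂ (j-prime , n<j , ≡j) rewrite ≡j | primeAbove-≡ {0} j-prime (≤-<-trans z≤n n<j) =
  ^-monoʳ-∣ j (<⇒≤pred n<j)

hasPrimeFactorsAbove⇒∣R : ∀ {n a} → HasPrimeFactors n a → PrimeFactorsAbove n a → a ∣ R a
hasPrimeFactorsAbove⇒∣R {n} {a} factors above =
  ∣-trans (∣Π-primeAbove^ factors above) (Π-pres-∣ (primeAbove^∣R-factor n) a)

avoidsMultiples : ∀ G F {n} → G ~∣ F → NFree F → 1 < n → (G ∈F) (λ a → ¬ n ∣ a)
avoidsMultiples G F {n} G~∣F nfree n>1 with ultra G (n ∣_)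
... | inj₂ ∤∈G = ∤∈G
... | inj₁ ∣∈G = ⊥-elim (nfree n n>1 (upward F _ _ (~∣-↑ G F (n ∣_) G~∣F ∣∈G)
                   λ x (x>0 , a , n∣a , a∣x) → ∣⇒multiple x>0 (∣-trans n∣a a∣x)))

PrimeFactorsAbove-≤1 : ∀ {n a} → n ≤ 1 → PrimeFactorsAbove n a
PrimeFactorsAbove-≤1 n≤1 p p-prime _ = ≤-<-trans n≤1 (prime>1 p-prime)

PrimeFactorsAbove-suc : ∀ {n a} → PrimeFactorsAbove n a → ¬ suc n ∣ a → PrimeFactorsAbove (suc n) a
PrimeFactorsAbove-suc above ∤a p p-prime p∣a with m≤n⇒m<n∨m≡n (above p p-prime p∣a)
... | inj₁ 1+n<p = 1+n<p
... | inj₂ refl  = ⊥-elim (∤a p∣a)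

PrimeFactorsAbove∈ : ∀ G F → G ~∣ F → NFree F → ∀ n → (G ∈F) (PrimeFactorsAbove n)
PrimeFactorsAbove∈ G _ _ _ zero       = upward G Pos _ (pos∈ G) λ _ _ → PrimeFactorsAbove-≤1 z≤n
PrimeFactorsAbove∈ G _ _ _ (suc zero) = upward G Pos _ (pos∈ G) λ _ _ → PrimeFactorsAbove-≤1 (s≤s z≤n)
PrimeFactorsAbove∈ G F G~∣F nfree (suc (suc n)) =
  upward G _ _ (inter G _ _ (PrimeFactorsAbove∈ G F G~∣F nfree (suc n))
                            (avoidsMultiples G F G~∣F nfree (s≤s (s≤s z≤n))))
    λ _ (above , ∤a) → PrimeFactorsAbove-suc above ∤a

NotDividingR : Subset
NotDividingR y = Pos y × ¬ y ∣ R y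

NotDividingR-InU : InU NotDividingR
NotDividingR-InU = InU-intro (λ _ → proj₁) λ {_} {y} (b>0 , b∤Rb) b∣y y>0 →
  y>0 , λ y∣Ry → b∤Rb (∣R⇒∣R-self y b>0 (∣-trans b∣y y∣Ry))

x^x∈NotDividingR : ∀ {x} → 2 ≤ x → NotDividingR (x ^ x)
x^x∈NotDividingR {x} x≥2 with primeDivisor x≥2
... | p , p-prime , p∣x =
  m^n>0 x x , λ x^x∣R → p^p∤R (x ^ x) p-prime (∣-trans p^p∣x^x x^x∣R)
  where
  instance
    x≢0 = >-nonZero (≤-trans (s≤s z≤n) x≥2)
  p^p∣x^x : p ^ p ∣ x ^ x
  p^p∣x^x = ∣-trans (^-monoˡ-∣ p p∣x) (^-monoʳ-∣ x (∣⇒≤ p∣x))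

selfPower : Ultrafilter → Ultrafilter
selfPower = image (λ x → x ^ x) λ x x>0 → m^n>0 x {{>-nonZero x>0}} x

selfPower-NFree : ∀ F → NFree F → NFree (selfPower F)
selfPower-NFree F nfree n n>1 nN∈ with primeDivisor n>1
... | p , p-prime , p∣n =
  nfree p (prime>1 p-prime) (upward F _ _ (inter F _ _ nN∈ (pos∈ F)) λ x (x^x∈nN , x>0) →
    ∣⇒multiple x>0 (prime∣^⇒∣ p-prime x (∣-trans p∣n (multiple⇒∣ x^x∈nN))))

NMAX∋NotDividingR : ∀ F → InNMAX F → (F ∈F) (λ x → 2 ≤ x) → (F ∈F) NotDividingR
NMAX∋NotDividingR F (nfree , maximal) ≥2∈F =
  maximal (selfPower F) (selfPower-NFree F nfree) NotDividingR NotDividingR-InU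
    (upward F _ _ ≥2∈F λ _ → x^x∈NotDividingR)

≥2∈ : ∀ G F → G ~∣ F → (G ∈F) (L 1) → (F ∈F) (λ x → 2 ≤ x)
≥2∈ G F G~∣F L1∈G = upward F _ _ (~∣-↑ G F (L 1) G~∣F L1∈G)
  λ { x (x>0 , _ , step p-prime one , a∣x) →
    ≤-trans (prime>1 p-prime) (∣⇒≤ {{>-nonZero x>0}} (∣-trans (m∣m*n 1) a∣x)) }

gcdR : ℕ → ℕ
gcdR x = gcd x (R x)

gcdR-pos : ∀ x → Pos x → Pos (gcdR x)
gcdR-pos (suc x) _ = n≢0⇒n>0 (gcd[m,n]≢0 (suc x) (R (suc x)) (inj₁ λ ()))

gcdR-image : Ultrafilter → Ultrafilter
gcdR-image = image gcdR gcdR-pos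

~∣-gcdR-image : ∀ G F n → NFree F → G ~∣ F → (G ∈F) (L n) → G ~∣ gcdR-image F
~∣-gcdR-image G F n nfree G~∣F Ln∈G A A∈U A∈G =
  upward F _ _ (~∣-↑ G F (A ∩ (L n ∩ PrimeFactorsAbove n)) G~∣F
                     (inter G _ _ A∈G (inter G _ _ Ln∈G (PrimeFactorsAbove∈ G F G~∣F nfree n))))
    λ x (x>0 , a , (Aa , a-factors , above) , a∣x) →
      InU-upward A∈U Aa (gcd-greatest a∣x (∣-trans (hasPrimeFactorsAbove⇒∣R a-factors above)
                                                     (Π-mono-∣ R-factor (∣⇒≤ {{>-nonZero x>0}} a∣x))))
                        (gcdR-pos x x>0)

gcdR∉NotDividingR : ∀ x → ¬ NotDividingR (gcdR x)
gcdR∉NotDividingR x (gcdR>0 , ∤) = ∤ (∣R⇒∣R-self x gcdR>0 (gcd[m,n]∣n x (R x)))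

lemma5p5 : (F : Ultrafilter) → InNMAX F → (G : ℕ → Ultrafilter) →
    ¬ (IsChain G × (∀ n → (G n ∈F) (L n)) × IsSmallestUB F G)
lemma5p5 F F∈NMAX@(nfree , _) G (_ , L∈G , upper , least) =
  ∅∉ F (upward F _ _ NotDividingR∈gcdR-image gcdR∉NotDividingR)
  where
  NotDividingR∈F : (F ∈F) NotDividingR
  NotDividingR∈F = NMAX∋NotDividingR F F∈NMAX (≥2∈ (G 1) F (upper 1) (L∈G 1))
  NotDividingR∈gcdR-image : (gcdR-image F ∈F) NotDividingR
  NotDividingR∈gcdR-image =
    least (gcdR-image F) (λ n → ~∣-gcdR-image (G n) F n nfree (upper n) (L∈G n))
          NotDividingR NotDividingR-InU NotDividingR∈F
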